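{- Let $P$ be a partial latin square of order $n$ whose filled cells are exactly those in the upper left $r\times s$ rectangle $R$, for some $r,s\in\{1,\dots,n\}$. Let $H$ be the set of cells in the top $r$ rows, and for each $\sigma\in\{1,\dots,n\}$ let $\nu(\sigma)$ be the number of times $\sigma$ appears in $R$. Then for each $\sigma$, \[\alpha(\sigma,H)=\min\{r,\ \nu(\sigma)+n-s\}.\]
   Context: A partial latin square of order $n$ is an $n\times n$ array in which some cells are filled with symbols from $\{1,\dots,n\}$, no symbol appearing twice in any row or column. A symbol is missing from a row (column) if it does not appear in a filled cell of that row (column). A cell supports $\sigma$ if it contains $\sigma$, or it is empty and $\sigma$ is missing from both its row and its column. A set of cells is independent if no two lie in the same row or column; an independent set for $\sigma$ is an independent set all of whose cells support $\sigma$. $\alpha(\sigma,T)$ is the maximum size of a subset of $T$ that is an independent set for $\sigma$. -}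

module Defs where

open import Data.Nat using (ℕ; _<_; _≤_; _∸_; _+_)
open import Data.Nat.Properties using (_<?_)
open import Data.Fin using (Fin; toℕ)
open import Data.Fin.Properties using () renaming (_≟_ to _≟ᶠ_)
open import Data.Maybe using (Maybe; just; nothing)
open import Data.Maybe.Properties using (≡-dec)
open import Data.Product using (Σ; _×_; _,_; proj₁; proj₂)
open import Data.Sum using (_⊎_)
open import Data.List using (List; length; filter; cartesianProduct; allFin)
open import Data.List.Relation.Unary.All using (All)
open import Data.List.Relation.Unary.AllPairs using (AllPairs)
open import Relation.Binary.PropositionalEquality using (_≡_; _≢_)
open import Relation.Nullary using (¬_)
open import Relation.Nullary.Decidable using (_×-dec_)

-- A (possibly partial) array of order n: cell (i , j) (row i, column j) is
-- either empty (nothing) or filled with a symbol (just σ).  Symbols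
-- {1,…,n} are represented by Fin n.
Array : ℕ → Set
Array n = Fin n → Fin n → Maybe (Fin n)

Cell : ℕ → Set
Cell n = Fin n × Fin n

IsPLS : ∀ {n} → Array n → Set
IsPLS {n} P =
  (∀ (i j j' : Fin n) (σ : Fin n) → P i j ≡ just σ → P i j' ≡ just σ → j ≡ j')
  × (∀ (i i' j : Fin n) (σ : Fin n) → P i j ≡ just σ → P i' j ≡ just σ → i ≡ i')

MissingRow : ∀ {n} → Array n → Fin n → Fin n → Set
MissingRow {n} P σ i = ∀ (j : Fin n) → ¬ (P i j ≡ just σ)

MissingCol : ∀ {n} → Array n → Fin n → Fin n → Set
MissingCol {n} P σ j = ∀ (i : Fin n) → ¬ (P i j ≡ just σ)

Supports : ∀ {n} → Array n → Fin n → Cell n → Set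
Supports P σ (i , j) =
  P i j ≡ just σ ⊎ (P i j ≡ nothing × MissingRow P σ i × MissingCol P σ j)

-- a list of cells is independent: pairwise in different rows and columns
-- (in particular the cells are pairwise distinct, so length = cardinality)
Independent : ∀ {n} → List (Cell n) → Set
Independent = AllPairs (λ c d → proj₁ c ≢ proj₁ d × proj₂ c ≢ proj₂ d)

IndepFor⊆ : ∀ {n} → Array n → Fin n → (Cell n → Set) → List (Cell n) → Set
IndepFor⊆ P σ T S = All T S × Independent S × All (Supports P σ) S

IsAlpha : ∀ {n} → Array n → Fin n → (Cell n → Set) → ℕ → Set
IsAlpha P σ T k =
  Σ (List _) (λ S → IndepFor⊆ P σ T S × length S ≡ k)
  × (∀ S → IndepFor⊆ P σ T S → length S ≤ k)

allCells : ∀ n → List (Cell n)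
allCells n = cartesianProduct (allFin n) (allFin n)

ν : ∀ {n} → Array n → ℕ → ℕ → Fin n → ℕ
ν {n} P r s σ = length (filter
  (λ c → ((toℕ (proj₁ c) <? r) ×-dec (toℕ (proj₂ c) <? s))
         ×-dec ≡-dec _≟ᶠ_ (P (proj₁ c) (proj₂ c)) (just σ))
  (allCells n))

-- The occurrences of σ in R are pairwise independent because P is latin; adding the cells that
-- pair the rows of H missing σ with the n − s columns right of R (empty cells supporting σ)
-- gives an independent set for σ in H of size min{r, ν + n − s}.  Conversely an independent
-- set in H has at most one cell per row, its cells inside R contain σ (cells of R are filled),
-- and its cells outside R lie in distinct columns among the last n − s.

module Submission where

open import Defs
open import Data.Nat using (ℕ; _<_; _≤_; _∸_; _+_; _⊓_; suc; z≤n; s≤s)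
open import Data.Nat.Properties
open import Data.Fin using (Fin; toℕ)
open import Data.Fin.Properties using (toℕ-injective; toℕ-fromℕ<; toℕ<n) renaming (_≟_ to _≟ᶠ_)
open import Data.Maybe using (just; nothing)
open import Data.Maybe.Properties using (≡-dec)
open import Data.Product using (Σ; _×_; _,_; proj₁; proj₂)
open import Data.Sum using (inj₁; inj₂)
open import Data.List using (List; []; _∷_; length; filter; map; _++_; zip; take; upTo; applyUpTo; allFin)
open import Data.List.Properties using (length-removeAt′; length-map; length-++; length-upTo; length-applyUpTo; length-take; length-zipWith)
open import Data.List.Membership.Propositional using (_∈_; _∉_)
open import Data.List.Membership.Propositional.Properties
  using (∈-filter⁺; ∈-filter⁻; ∈-map⁺; ∈-map⁻; ∈-++⁺ˡ; ∈-++⁺ʳ; ∈-upTo⁺; ∈-upTo⁻;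
         ∈-applyUpTo⁺; ∈-applyUpTo⁻; ∈-allFin; ∈-cartesianProduct⁺)
open import Data.List.Relation.Binary.Subset.Propositional using (_⊆_)
open import Data.List.Relation.Unary.Any as Any using (here; there)
open import Data.List.Relation.Unary.All as All using (All; []; _∷_)
import Data.List.Relation.Unary.All.Properties as All
open import Data.List.Relation.Unary.AllPairs as AllPairs using (AllPairs; []; _∷_)
import Data.List.Relation.Unary.AllPairs.Properties as AllPairs
open import Data.List.Relation.Unary.Unique.Propositional using (Unique)
import Data.List.Relation.Unary.Unique.Propositional.Properties as Unique
open import Relation.Binary.PropositionalEquality
open import Relation.Nullary using (¬_; yes; no; ¬?)
open import Relation.Nullary.Decidable using (_×-dec_)
open import Relation.Unary using (Pred; Decidable)
open import Relation.Unary.Properties using (∁?)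
open import Data.Empty using (⊥-elim)

module _ {a} {A : Set a} where

  ∈-─⁺ : ∀ {x y : A} {ys} (x∈ys : x ∈ ys) → y ∈ ys → y ≢ x → y ∈ (ys Any.─ x∈ys)
  ∈-─⁺ (here refl) (here refl) y≢x = ⊥-elim (y≢x refl)
  ∈-─⁺ (here _)    (there y∈)  _   = y∈
  ∈-─⁺ (there _)   (here y≡)   _   = here y≡
  ∈-─⁺ (there x∈)  (there y∈)  y≢x = there (∈-─⁺ x∈ y∈ y≢x)

  Unique∧⊆⇒length≤ : ∀ {xs ys : List A} → Unique xs → xs ⊆ ys → length xs ≤ length ys
  Unique∧⊆⇒length≤ {[]}     _            _  = z≤n
  Unique∧⊆⇒length≤ {x ∷ xs} {ys} (x∉xs ∷ u) xs⊆ys = begin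
    suc (length xs)                ≤⟨ s≤s (Unique∧⊆⇒length≤ u step) ⟩
    suc (length (ys Any.─ x∈ys))   ≡⟨ sym (length-removeAt′ ys (Any.index x∈ys)) ⟩
    length ys                      ∎
    where
    open ≤-Reasoning
    x∈ys = xs⊆ys (here refl)
    step : xs ⊆ (ys Any.─ x∈ys)
    step y∈xs = ∈-─⁺ x∈ys (xs⊆ys (there y∈xs)) (λ y≡x → All.lookup x∉xs y∈xs (sym y≡x))

  length-filter+length-filter∁ : ∀ {p} {P : Pred A p} (P? : Decidable P) xs →
    length (filter P? xs) + length (filter (∁? P?) xs) ≡ length xs
  length-filter+length-filter∁ P? []       = refl
  length-filter+length-filter∁ P? (x ∷ xs) with P? x
  ... | yes _ = cong suc (length-filter+length-filter∁ P? xs)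
  ... | no  _ = trans (+-suc _ _) (cong suc (length-filter+length-filter∁ P? xs))

  AllPairs-map-within : ∀ {p r t} {P : Pred A p} {R : A → A → Set r} {T : A → A → Set t} →
    (∀ {x y} → P x → P y → R x y → T x y) → ∀ {xs} → All P xs → AllPairs R xs → AllPairs T xs
  AllPairs-map-within f []         []         = []
  AllPairs-map-within f (px ∷ pxs) (rx ∷ rxs) =
    All.zipWith (λ (r , py) → f px py r) (rx , pxs) ∷ AllPairs-map-within f pxs rxs

module _ {a b} {A : Set a} {B : Set b} where

  ∈-zip⁻ : ∀ {c : A × B} xs ys → c ∈ zip xs ys → proj₁ c ∈ xs × proj₂ c ∈ ys
  ∈-zip⁻ (x ∷ xs) (y ∷ ys) (here refl) = here refl , here refl
  ∈-zip⁻ (x ∷ xs) (y ∷ ys) (there c∈)  =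
    let x∈ , y∈ = ∈-zip⁻ xs ys c∈ in there x∈ , there y∈

  zip-coordinatewise-distinct : ∀ {xs : List A} {ys : List B} → Unique xs → Unique ys →
    AllPairs (λ c d → proj₁ c ≢ proj₁ d × proj₂ c ≢ proj₂ d) (zip xs ys)
  zip-coordinatewise-distinct {[]}     {_}      _          _          = []
  zip-coordinatewise-distinct {_ ∷ _}  {[]}     _          _          = []
  zip-coordinatewise-distinct {_ ∷ xs} {_ ∷ ys} (x∉ ∷ uxs) (y∉ ∷ uys) =
    All.tabulate (λ d∈ → let x∈ , y∈ = ∈-zip⁻ xs ys d∈ in All.lookup x∉ x∈ , All.lookup y∉ y∈)
    ∷ zip-coordinatewise-distinct uxs uys

Unique∧covers⇒length≤ : ∀ {n} {ks : List ℕ} {is : List (Fin n)} → Unique ks → All (_< n) ks →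
  (∀ i → toℕ i ∈ ks → i ∈ is) → length ks ≤ length is
Unique∧covers⇒length≤ {n} {ks} {is} uks ks<n covers =
  subst (length ks ≤_) (length-map toℕ is) (Unique∧⊆⇒length≤ uks ks⊆is)
  where
  ks⊆is : ks ⊆ map toℕ is
  ks⊆is {k} k∈ks =
    let k<n = All.lookup ks<n k∈ks
        i≡k = toℕ-fromℕ< k<n
    in subst (_∈ map toℕ is) i≡k (∈-map⁺ toℕ (covers _ (subst (_∈ ks) (sym i≡k) k∈ks)))

interval : ℕ → ℕ → List ℕ
interval s n = applyUpTo (s +_) (n ∸ s)

length-interval : ∀ s n → length (interval s n) ≡ n ∸ s
length-interval s n = length-applyUpTo (s +_) (n ∸ s)

interval-unique : ∀ s n → Unique (interval s n)
interval-unique s n = Unique.applyUpTo⁺₁ (s +_) (n ∸ s) (λ i<j _ → <⇒≢ (+-monoʳ-< s i<j))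

∈-interval⁺ : ∀ {s n k} → s ≤ k → k < n → k ∈ interval s n
∈-interval⁺ {s} {n} {k} s≤k k<n =
  subst (_∈ interval s n) (m+[n∸m]≡n s≤k) (∈-applyUpTo⁺ (s +_) (∸-monoˡ-< k<n s≤k))

∈-interval⁻ : ∀ {s n k} → k ∈ interval s n → s ≤ k × k < n
∈-interval⁻ {s} {n} k∈ with i , i<n∸s , refl ← ∈-applyUpTo⁻ (s +_) k∈ =
  m≤m+n s i , subst (s + i <_) (m+[n∸m]≡n s≤n) (+-monoʳ-< s i<n∸s)
  where
  s≤n : s ≤ n
  s≤n = <⇒≤ (m∸n≢0⇒n<m (λ n∸s≡0 → n≮0 (subst (i <_) n∸s≡0 i<n∸s)))

module _ {n : ℕ} {S : List (Cell n)} (independent : Independent S) where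

  Independent⇒Unique : Unique S
  Independent⇒Unique = AllPairs.map (λ (rows≢ , _) c≡d → rows≢ (cong proj₁ c≡d)) independent

  Independent⇒rows-unique : Unique (map (λ c → toℕ (proj₁ c)) S)
  Independent⇒rows-unique =
    AllPairs.map⁺ (AllPairs.map (λ (rows≢ , _) e → rows≢ (toℕ-injective e)) independent)

  Independent⇒columns-unique : Unique (map (λ c → toℕ (proj₂ c)) S)
  Independent⇒columns-unique =
    AllPairs.map⁺ (AllPairs.map (λ (_ , columns≢) e → columns≢ (toℕ-injective e)) independent)

  Independent∧rows<r⇒length≤r : ∀ {r} → All (λ c → toℕ (proj₁ c) < r) S → length S ≤ r
  Independent∧rows<r⇒length≤r {r} rows<r = begin
    length S                              ≡⟨ sym (length-map _ S) ⟩
    length (map (λ c → toℕ (proj₁ c)) S)  ≤⟨ Unique∧⊆⇒length≤ Independent⇒rows-unique rows⊆ ⟩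
    length (upTo r)                       ≡⟨ length-upTo r ⟩
    r                                     ∎
    where
    open ≤-Reasoning
    rows⊆ : map (λ c → toℕ (proj₁ c)) S ⊆ upTo r
    rows⊆ k∈ with c , c∈ , refl ← ∈-map⁻ _ k∈ = ∈-upTo⁺ (All.lookup rows<r c∈)

occurrences-independent : ∀ {n} {P : Array n} → IsPLS P → ∀ {σ} {c d : Cell n} →
  P (proj₁ c) (proj₂ c) ≡ just σ → P (proj₁ d) (proj₂ d) ≡ just σ → c ≢ d →
  proj₁ c ≢ proj₁ d × proj₂ c ≢ proj₂ d
occurrences-independent (rowLatin , colLatin) {σ} {i , j} {i' , j'} c∋σ d∋σ c≢d =
  (λ { refl → c≢d (cong (i ,_) (rowLatin i j j' σ c∋σ d∋σ)) }) ,
  (λ { refl → c≢d (cong (_, j) (colLatin i i' j σ c∋σ d∋σ)) })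

module FilledRectangle {n r s : ℕ} (r≤n : r ≤ n) {P : Array n} (pls : IsPLS P)
  (shape : ∀ (i j : Fin n) → (toℕ i < r × toℕ j < s → Σ (Fin n) (λ σ → P i j ≡ just σ))
                           × (¬ (toℕ i < r × toℕ j < s) → P i j ≡ nothing))
  (σ : Fin n) where

  open import Data.List.Membership.DecPropositional (_≟ᶠ_ {n}) using (_∈?_)

  InH : Cell n → Set
  InH c = toℕ (proj₁ c) < r

  InR : Cell n → Set
  InR c = toℕ (proj₁ c) < r × toℕ (proj₂ c) < s

  inR? : Decidable InR
  inR? c = (toℕ (proj₁ c) <? r) ×-dec (toℕ (proj₂ c) <? s)

  Contains : Fin n → Cell n → Set
  Contains τ c = P (proj₁ c) (proj₂ c) ≡ just τ

  filled⇒inR : ∀ {τ} c → Contains τ c → InR c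
  filled⇒inR c@(i , j) c∋τ with inR? c
  ... | yes c∈R = c∈R
  ... | no  c∉R with () ← trans (sym c∋τ) (proj₂ (shape i j) c∉R)

  supports∧inR⇒contains : ∀ c → InR c → Supports P σ c → Contains σ c
  supports∧inR⇒contains c           _   (inj₁ c∋σ)       = c∋σ
  supports∧inR⇒contains c@(i , j) c∈R (inj₂ (empty , _)) with τ , c∋τ ← proj₁ (shape i j) c∈R
    with () ← trans (sym empty) c∋τ

  -- Definitionally the list whose length is ν P r s σ.
  σ-cells : List (Cell n)
  σ-cells = filter (λ c → inR? c ×-dec ≡-dec _≟ᶠ_ (P (proj₁ c) (proj₂ c)) (just σ)) (allCells n)

  ∈-σ-cells⁺ : ∀ c → InR c → Contains σ c → c ∈ σ-cells
  ∈-σ-cells⁺ (i , j) c∈R c∋σ =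
    ∈-filter⁺ _ (∈-cartesianProduct⁺ (∈-allFin i) (∈-allFin j)) (c∈R , c∋σ)

  ∈-σ-cells⁻ : ∀ {c} → c ∈ σ-cells → InR c × Contains σ c
  ∈-σ-cells⁻ c∈ = proj₂ (∈-filter⁻ _ {xs = allCells n} c∈)

  σ-cells-independent : Independent σ-cells
  σ-cells-independent =
    AllPairs-map-within (λ c∈ d∈ → occurrences-independent pls (proj₂ c∈) (proj₂ d∈))
      (All.tabulate ∈-σ-cells⁻)
      (Unique.filter⁺ _ (Unique.cartesianProduct⁺ (Unique.allFin⁺ n) (Unique.allFin⁺ n)))

  σ-rows : List (Fin n)
  σ-rows = map proj₁ σ-cells

  σ-free-rows : List (Fin n)
  σ-free-rows = filter (λ i → (toℕ i <? r) ×-dec ¬? (i ∈? σ-rows)) (allFin n)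

  outer-columns : List (Fin n)
  outer-columns = filter (λ j → s ≤? toℕ j) (allFin n)

  ∈-σ-free-rows⁻ : ∀ {i} → i ∈ σ-free-rows → toℕ i < r × i ∉ σ-rows
  ∈-σ-free-rows⁻ i∈ = proj₂ (∈-filter⁻ _ {xs = allFin n} i∈)

  ∈-outer-columns⁻ : ∀ {j} → j ∈ outer-columns → s ≤ toℕ j
  ∈-outer-columns⁻ j∈ = proj₂ (∈-filter⁻ _ {xs = allFin n} j∈)

  r≤|σ-cells|+|σ-free-rows| : r ≤ length σ-cells + length σ-free-rows
  r≤|σ-cells|+|σ-free-rows| = begin
    r                                        ≡⟨ sym (length-upTo r) ⟩
    length (upTo r)                          ≤⟨ Unique∧covers⇒length≤ (Unique.upTo⁺ r) upTo<n covers ⟩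
    length (σ-rows ++ σ-free-rows)           ≡⟨ length-++ σ-rows ⟩
    length σ-rows + length σ-free-rows       ≡⟨ cong (_+ length σ-free-rows) (length-map proj₁ σ-cells) ⟩
    length σ-cells + length σ-free-rows      ∎
    where
    open ≤-Reasoning
    upTo<n : All (_< n) (upTo r)
    upTo<n = All.tabulate (λ k∈ → ≤-trans (∈-upTo⁻ k∈) r≤n)
    covers : ∀ i → toℕ i ∈ upTo r → i ∈ σ-rows ++ σ-free-rows
    covers i i∈ with i ∈? σ-rows
    ... | yes i∈σ-rows = ∈-++⁺ˡ i∈σ-rows
    ... | no  i∉σ-rows = ∈-++⁺ʳ σ-rows (∈-filter⁺ _ (∈-allFin i) (∈-upTo⁻ i∈ , i∉σ-rows))

  n∸s≤|outer-columns| : n ∸ s ≤ length outer-columns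
  n∸s≤|outer-columns| =
    subst (_≤ length outer-columns) (length-interval s n)
      (Unique∧covers⇒length≤ (interval-unique s n) (All.tabulate (λ k∈ → proj₂ (∈-interval⁻ k∈)))
        (λ j j∈ → ∈-filter⁺ _ (∈-allFin j) (proj₁ (∈-interval⁻ j∈))))

  new-cells : List (Cell n)
  new-cells = zip σ-free-rows outer-columns

  ∈-new-cells⁻ : ∀ {c} → c ∈ new-cells → (toℕ (proj₁ c) < r × proj₁ c ∉ σ-rows) × s ≤ toℕ (proj₂ c)
  ∈-new-cells⁻ c∈ =
    let i∈ , j∈ = ∈-zip⁻ σ-free-rows outer-columns c∈
    in ∈-σ-free-rows⁻ i∈ , ∈-outer-columns⁻ j∈

  new-cells-support : All (Supports P σ) new-cells
  new-cells-support = All.tabulate λ { {i , j} c∈ → supports (∈-new-cells⁻ c∈) }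
    where
    supports : ∀ {i j} → (toℕ i < r × i ∉ σ-rows) × s ≤ toℕ j → Supports P σ (i , j)
    supports {i} {j} ((_ , i∉σ-rows) , s≤j) = inj₂
      ( proj₂ (shape i j) (λ (_ , j<s) → <⇒≱ j<s s≤j)
      , (λ j' i,j'∋σ → i∉σ-rows (∈-map⁺ proj₁ (∈-σ-cells⁺ (i , j') (filled⇒inR (i , j') i,j'∋σ) i,j'∋σ)))
      , (λ i' i',j∋σ → <⇒≱ (proj₂ (filled⇒inR (i' , j) i',j∋σ)) s≤j) )

  transversal : List (Cell n)
  transversal = σ-cells ++ new-cells

  transversal-inH : All InH transversal
  transversal-inH = All.++⁺ (All.tabulate (λ c∈ → proj₁ (proj₁ (∈-σ-cells⁻ c∈))))
                            (All.tabulate (λ c∈ → proj₁ (proj₁ (∈-new-cells⁻ c∈))))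

  transversal-supports : All (Supports P σ) transversal
  transversal-supports = All.++⁺ (All.tabulate (λ c∈ → inj₁ (proj₂ (∈-σ-cells⁻ c∈)))) new-cells-support

  transversal-independent : Independent transversal
  transversal-independent = AllPairs.++⁺ σ-cells-independent
    (zip-coordinatewise-distinct (Unique.filter⁺ _ (Unique.allFin⁺ n)) (Unique.filter⁺ _ (Unique.allFin⁺ n)))
    (All.tabulate λ c∈ → All.tabulate λ d∈ →
      let (_ , d∉σ-rows) , s≤d = ∈-new-cells⁻ d∈
      in (λ c≡d → d∉σ-rows (subst (_∈ σ-rows) c≡d (∈-map⁺ proj₁ c∈)))
       , (λ c≡d → <⇒≱ (subst (λ j → toℕ j < s) c≡d (proj₂ (proj₁ (∈-σ-cells⁻ c∈)))) s≤d))

  length-transversal : r ⊓ (length σ-cells + (n ∸ s)) ≤ length transversal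
  length-transversal = begin
    r ⊓ (length σ-cells + (n ∸ s))
      ≤⟨ ⊓-mono-≤ r≤|σ-cells|+|σ-free-rows| (+-monoʳ-≤ (length σ-cells) n∸s≤|outer-columns|) ⟩
    (length σ-cells + length σ-free-rows) ⊓ (length σ-cells + length outer-columns)
      ≡⟨ sym (+-distribˡ-⊓ (length σ-cells) _ _) ⟩
    length σ-cells + length σ-free-rows ⊓ length outer-columns
      ≡⟨ cong (length σ-cells +_) (sym (length-zipWith _,_ σ-free-rows outer-columns)) ⟩
    length σ-cells + length new-cells
      ≡⟨ sym (length-++ σ-cells) ⟩
    length transversal ∎
    where open ≤-Reasoning

  length≤|σ-cells|+n∸s : ∀ {S} → IndepFor⊆ P σ InH S → length S ≤ length σ-cells + (n ∸ s)
  length≤|σ-cells|+n∸s {S} (inH , independent , supports) = begin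
    length S                          ≡⟨ sym (length-filter+length-filter∁ inR? S) ⟩
    length inside + length outside    ≤⟨ +-mono-≤ |inside|≤ |outside|≤ ⟩
    length σ-cells + (n ∸ s)          ∎
    where
    open ≤-Reasoning
    inside outside : List (Cell n)
    inside  = filter inR? S
    outside = filter (∁? inR?) S
    |inside|≤ : length inside ≤ length σ-cells
    |inside|≤ = Unique∧⊆⇒length≤ (Unique.filter⁺ inR? (Independent⇒Unique independent)) λ c∈ →
      let c∈S , c∈R = ∈-filter⁻ inR? c∈
      in ∈-σ-cells⁺ _ c∈R (supports∧inR⇒contains _ c∈R (All.lookup supports c∈S))
    outside-columns : map (λ c → toℕ (proj₂ c)) outside ⊆ interval s n
    outside-columns k∈ with (i , j) , c∈ , refl ← ∈-map⁻ _ k∈ =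
      let c∈S , c∉R = ∈-filter⁻ (∁? inR?) {xs = S} c∈
      in ∈-interval⁺ (≮⇒≥ (λ j<s → c∉R (All.lookup inH c∈S , j<s))) (toℕ<n j)
    |outside|≤ : length outside ≤ n ∸ s
    |outside|≤ = begin
      length outside                                  ≡⟨ sym (length-map _ outside) ⟩
      length (map (λ c → toℕ (proj₂ c)) outside)
        ≤⟨ Unique∧⊆⇒length≤ (Independent⇒columns-unique (AllPairs.filter⁺ _ independent)) outside-columns ⟩
      length (interval s n)                           ≡⟨ length-interval s n ⟩
      n ∸ s                                           ∎

  α≡r⊓[ν+n∸s] : IsAlpha P σ InH (r ⊓ (length σ-cells + (n ∸ s)))
  α≡r⊓[ν+n∸s] = (take m transversal , take-independentFor , take-length) , maximal
    where
    m : ℕ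
    m = r ⊓ (length σ-cells + (n ∸ s))
    take-independentFor : IndepFor⊆ P σ InH (take m transversal)
    take-independentFor = All.take⁺ m transversal-inH
                        , AllPairs.take⁺ m transversal-independent
                        , All.take⁺ m transversal-supports
    take-length : length (take m transversal) ≡ m
    take-length = trans (length-take m transversal) (m≤n⇒m⊓n≡m length-transversal)
    maximal : ∀ S → IndepFor⊆ P σ InH S → length S ≤ m
    maximal S S-indep@(inH , independent , _) =
      ⊓-glb (Independent∧rows<r⇒length≤r independent inH) (length≤|σ-cells|+n∸s S-indep)

lemma5 : (n r s : ℕ) → 1 ≤ r → r ≤ n → 1 ≤ s → s ≤ n →
    (P : Array n) → IsPLS P →
    (∀ (i j : Fin n) → (toℕ i < r × toℕ j < s → Σ (Fin n) (λ σ → P i j ≡ just σ))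
                     × (¬ (toℕ i < r × toℕ j < s) → P i j ≡ nothing)) →
    (σ : Fin n) →
    IsAlpha P σ (λ c → toℕ (proj₁ c) < r) (r ⊓ (ν P r s σ + (n ∸ s)))
lemma5 n r s _ r≤n _ _ P pls shape σ = FilledRectangle.α≡r⊓[ν+n∸s] r≤n pls shape σ
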